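{- If $G$ is a $2$-connected chordal graph, then $r_\Delta(G)=\max\{2,\alpha(G)\}$.
   Context: All graphs are finite, simple, undirected and connected. A graph is chordal if every cycle on four or more vertices has a chord. $\alpha(G)$ is the independence number. For $S\subseteq V(G)$, the $\Delta$-interval $[S]$ is the set consisting of all vertices of $S$ together with every vertex $v$ adjacent to both $x$ and $y$ for some pair of adjacent vertices $x,y\in S$. A set $S$ is $\Delta$-convex if $[S]=S$, and $\langle S\rangle$ denotes the smallest $\Delta$-convex set containing $S$ ($\langle\emptyset\rangle=\emptyset$). A set $S$ is Radon dependent if there is a partition $\{S_1,S_2\}$ of $S$ with $\langle S_1\rangle\cap\langle S_2\rangle\neq\emptyset$, and Radon independent otherwise. The Radon number $r_\Delta(G)$ is the least integer $n\ge0$ such that every $S\subseteq V(G)$ with $|S|>n$ is Radon dependent (equivalently, the maximum size of a Radon independent set). -}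

module Defs where

open import Data.Nat using (ℕ; zero; suc; _≤_; _<_; _∸_; _⊔_)
open import Data.Fin using (Fin; toℕ)
open import Data.Fin.Subset using (Subset; _∈_; _∉_; _⊆_; _∪_; _∩_; Empty; ∣_∣)
open import Data.Bool using (Bool; true; false)
open import Data.Product using (Σ; _×_; _,_; ∃; ∃-syntax)
open import Data.Sum using (_⊎_)
open import Data.Unit using (⊤)
open import Relation.Nullary using (¬_)
open import Relation.Binary.PropositionalEquality using (_≡_; _≢_)
open import Function.Definitions using (Injective)

record Graph (n : ℕ) : Set where
  field
    adj     : Fin n → Fin n → Bool
    sym     : ∀ x y → adj x y ≡ adj y x
    irrefl  : ∀ x → adj x x ≡ false

open Graph public

Adj : ∀ {n} → Graph n → Fin n → Fin n → Set
Adj G x y = adj G x y ≡ true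

data WalkIn {n} (G : Graph n) (P : Fin n → Set) : Fin n → Fin n → Set where
  here : ∀ {u} → P u → WalkIn G P u u
  step : ∀ {u w v} → P u → Adj G u w → WalkIn G P w v → WalkIn G P u v

Connected : ∀ {n} → Graph n → Set
Connected {n} G = ∀ (u v : Fin n) → WalkIn G (λ _ → ⊤) u v

ConnectedWithout : ∀ {n} → Graph n → Fin n → Set
ConnectedWithout {n} G x = ∀ (u v : Fin n) → u ≢ x → v ≢ x → WalkIn G (λ w → w ≢ x) u v

TwoConnected : ∀ {n} → Graph n → Set
TwoConnected {n} G = (3 ≤ n) × Connected G × (∀ x → ConnectedWithout G x)

CycConsec : ∀ {k} → Fin k → Fin k → Set
CycConsec {k} i j =
  (toℕ j ≡ suc (toℕ i)) ⊎ (toℕ i ≡ suc (toℕ j))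
  ⊎ ((toℕ i ≡ 0 × toℕ j ≡ k ∸ 1) ⊎ (toℕ j ≡ 0 × toℕ i ≡ k ∸ 1))

IsCycle : ∀ {n k} → Graph n → (Fin k → Fin n) → Set
IsCycle {k = k} G c = Injective _≡_ _≡_ c × (∀ i j → CycConsec {k} i j → Adj G (c i) (c j))

HasChord : ∀ {n k} → Graph n → (Fin k → Fin n) → Set
HasChord {k = k} G c = ∃[ i ] ∃[ j ] (i ≢ j × ¬ CycConsec {k} i j × Adj G (c i) (c j))

Chordal : ∀ {n} → Graph n → Set
Chordal {n} G = ∀ (k : ℕ) → 4 ≤ k → (c : Fin k → Fin n) → IsCycle G c → HasChord G c

Independent : ∀ {n} → Graph n → Subset n → Set
Independent G S = ∀ x y → x ∈ S → y ∈ S → ¬ Adj G x y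

IsIndependenceNumber : ∀ {n} → Graph n → ℕ → Set
IsIndependenceNumber G a =
  (∃[ S ] (Independent G S × ∣ S ∣ ≡ a)) × (∀ S → Independent G S → ∣ S ∣ ≤ a)

-- S is Δ-convex: [S] = S, i.e. every common neighbour of two adjacent
-- vertices of S lies in S
ΔConvex : ∀ {n} → Graph n → Subset n → Set
ΔConvex G S = ∀ x y v → x ∈ S → y ∈ S → Adj G x y → Adj G v x → Adj G v y → v ∈ S

InHull : ∀ {n} → Graph n → Subset n → Fin n → Set
InHull G S v = ∀ T → S ⊆ T → ΔConvex G T → v ∈ T

-- {S₁, S₂} is a partition of S (parts may be empty)
IsPartition : ∀ {n} → Subset n → Subset n → Subset n → Set
IsPartition S S₁ S₂ = (S₁ ∪ S₂ ≡ S) × Empty (S₁ ∩ S₂)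

RadonDependent : ∀ {n} → Graph n → Subset n → Set
RadonDependent G S =
  ∃[ S₁ ] ∃[ S₂ ] (IsPartition S S₁ S₂ × ∃[ v ] (InHull G S₁ v × InHull G S₂ v))

IsRadonNumber : ∀ {n} → Graph n → ℕ → Set
IsRadonNumber G r =
  (∀ S → r < ∣ S ∣ → RadonDependent G S)
  × (∀ m → (∀ S → m < ∣ S ∣ → RadonDependent G S) → r ≤ m)

-- Let T be a Δ-convex set of a 2-connected chordal graph containing an edge ab, and v another
-- neighbour of a.  As G - a is connected there is an induced path v = q₀, …, qₘ = b avoiding a.
-- If a ~ qⱼ for some j ≥ 2 but a is adjacent to none of q₁, …, qⱼ₋₁, then a q₀ … qⱼ is a chordless
-- cycle; so a ~ q₁, and by induction along the path q₁ ∈ T, whence q₀ = v ∈ T as a common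
-- neighbour of the adjacent a, q₁ ∈ T.  Spreading along walks, T is the whole vertex set.
-- Hence a set S with an edge xy and a third vertex is Radon dependent (split it into S ∩ {x, y}
-- and the rest), while independent sets, whose parts are their own hulls, and pairs are Radon
-- independent.
module Submission where

open import Defs
open import Data.Bool using (true; false)
import Data.Bool.Properties as Bool
open import Data.Empty using (⊥)
open import Data.Fin using (Fin; toℕ; zero; suc)
open import Data.Fin.Properties using (toℕ-injective; toℕ<n; any?)
import Data.Fin as Fin
open import Data.Fin.Subset using (Subset; _∈_; _⊆_; _∪_; _∩_; ∁; ⊤; ⁅_⁆; Empty; Nonempty; ∣_∣)
open import Data.Fin.Subset.Properties
  using ( _∈?_; nonempty?; x∈p∩q⁺; x∈p∩q⁻; x∈p∪q⁻; p⊆p∪q; q⊆p∪q; x∈⁅x⁆; x∈⁅y⁆⇒x≡y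
        ; ∣⁅x⁆∣≡1; p⊆q⇒∣p∣≤∣q∣; x∈p⇒x∉∁p; x∉p⇒x∈∁p; p∪∁p≡⊤; ∩-distribˡ-∪; ∩-identityʳ
        ; ∪-comm; ∩-comm )
open import Data.Nat using (ℕ; zero; suc; _+_; _≤_; _<_; z≤n; s≤s; _⊔_; _≟_)
open import Data.Nat.Properties
open import Data.Product using (∃; _×_; _,_; proj₁; proj₂)
open import Data.Sum using (_⊎_; inj₁; inj₂; swap)
open import Data.Vec using (_∷_; [])
open import Function using (_∘_)
open import Relation.Binary using (tri<; tri≈; tri>)
import Relation.Binary.PropositionalEquality as ≡
open ≡ using (_≡_; _≢_; refl; subst; subst₂; cong; cong₂; ≢-sym)
open import Relation.Nullary using (¬_; Dec; yes; no; contradiction)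
open import Relation.Nullary.Decidable using (_×-dec_; _⊎-dec_)
open import Relation.Unary using (Decidable)

least : ∀ {P : ℕ → Set} → Decidable P → ∀ {k} → P k →
        ∃ λ j → j ≤ k × P j × (∀ {i} → i < j → ¬ P i)
least P? pk with P? 0
... | yes p0 = 0 , z≤n , p0 , λ ()
least P? {zero}  pk | no ¬p0 = contradiction pk ¬p0
least P? {suc k} pk | no ¬p0 with least (P? ∘ suc) pk
... | j , j≤k , pj , below =
  suc j , s≤s j≤k , pj , λ { {zero} _ → ¬p0 ; {suc i} (s≤s i<j) → below i<j }

_◃_ : ∀ {A : Set} → A → (ℕ → A) → ℕ → A
(x ◃ f) zero    = x
(x ◃ f) (suc i) = f i

≢-pair-covers : ∀ {A : Set} {x y p q z : A} → p ≡ x ⊎ p ≡ y → q ≡ x ⊎ q ≡ y → p ≢ q →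
                z ≡ x ⊎ z ≡ y → z ≡ p ⊎ z ≡ q
≢-pair-covers (inj₁ refl) (inj₁ refl) p≢q _ = contradiction refl p≢q
≢-pair-covers (inj₂ refl) (inj₂ refl) p≢q _ = contradiction refl p≢q
≢-pair-covers (inj₁ refl) (inj₂ refl) _   z = z
≢-pair-covers (inj₂ refl) (inj₁ refl) _   z = swap z

∣p∪q∣≤∣p∣+∣q∣ : ∀ {m} (p q : Subset m) → ∣ p ∪ q ∣ ≤ ∣ p ∣ + ∣ q ∣
∣p∪q∣≤∣p∣+∣q∣ []          []          = z≤n
∣p∪q∣≤∣p∣+∣q∣ (true ∷ p)  (true ∷ q)  =
  s≤s (≤-trans (∣p∪q∣≤∣p∣+∣q∣ p q) (+-monoʳ-≤ ∣ p ∣ (n≤1+n _)))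
∣p∪q∣≤∣p∣+∣q∣ (true ∷ p)  (false ∷ q) = s≤s (∣p∪q∣≤∣p∣+∣q∣ p q)
∣p∪q∣≤∣p∣+∣q∣ (false ∷ p) (true ∷ q)  =
  ≤-trans (s≤s (∣p∪q∣≤∣p∣+∣q∣ p q)) (≤-reflexive (≡.sym (+-suc ∣ p ∣ ∣ q ∣)))
∣p∪q∣≤∣p∣+∣q∣ (false ∷ p) (false ∷ q) = ∣p∪q∣≤∣p∣+∣q∣ p q

module _ {m : ℕ} where

  ∣⁅x⁆∪⁅y⁆∣≤2 : ∀ (x y : Fin m) → ∣ ⁅ x ⁆ ∪ ⁅ y ⁆ ∣ ≤ 2
  ∣⁅x⁆∪⁅y⁆∣≤2 x y =
    subst (∣ ⁅ x ⁆ ∪ ⁅ y ⁆ ∣ ≤_) (cong₂ _+_ (∣⁅x⁆∣≡1 x) (∣⁅x⁆∣≡1 y)) (∣p∪q∣≤∣p∣+∣q∣ ⁅ x ⁆ ⁅ y ⁆)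

  x∈⁅x⁆∪⁅y⁆ : ∀ (x y : Fin m) → x ∈ ⁅ x ⁆ ∪ ⁅ y ⁆
  x∈⁅x⁆∪⁅y⁆ x y = p⊆p∪q ⁅ y ⁆ (x∈⁅x⁆ x)

  y∈⁅x⁆∪⁅y⁆ : ∀ (x y : Fin m) → y ∈ ⁅ x ⁆ ∪ ⁅ y ⁆
  y∈⁅x⁆∪⁅y⁆ x y = q⊆p∪q ⁅ x ⁆ ⁅ y ⁆ (x∈⁅x⁆ y)

  ∈⁅x⁆∪⁅y⁆⇒ : ∀ {x y z : Fin m} → z ∈ ⁅ x ⁆ ∪ ⁅ y ⁆ → z ≡ x ⊎ z ≡ y
  ∈⁅x⁆∪⁅y⁆⇒ {x} {y} z∈ with x∈p∪q⁻ ⁅ x ⁆ ⁅ y ⁆ z∈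
  ... | inj₁ z∈⁅x⁆ = inj₁ (x∈⁅y⁆⇒x≡y x z∈⁅x⁆)
  ... | inj₂ z∈⁅y⁆ = inj₂ (x∈⁅y⁆⇒x≡y y z∈⁅y⁆)

  Empty[p∩∁q]⇒p⊆q : ∀ {p q : Subset m} → Empty (p ∩ ∁ q) → p ⊆ q
  Empty[p∩∁q]⇒p⊆q {p} {q} empty {x} x∈p with x ∈? q
  ... | yes x∈q = x∈q
  ... | no  x∉q = contradiction (x , x∈p∩q⁺ (x∈p , x∉p⇒x∈∁p x∉q)) empty

  IsPartition-⊆ˡ : ∀ {S S₁ S₂ : Subset m} → IsPartition S S₁ S₂ → S₁ ⊆ S
  IsPartition-⊆ˡ {S₂ = S₂} (union , _) x∈ = subst (_ ∈_) union (p⊆p∪q S₂ x∈)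

  IsPartition-swap : ∀ {S S₁ S₂ : Subset m} → IsPartition S S₁ S₂ → IsPartition S S₂ S₁
  IsPartition-swap {S₁ = S₁} {S₂} (union , disjoint) =
    ≡.trans (∪-comm S₂ S₁) union , subst Empty (∩-comm S₁ S₂) disjoint

  IsPartition-⊆ʳ : ∀ {S S₁ S₂ : Subset m} → IsPartition S S₁ S₂ → S₂ ⊆ S
  IsPartition-⊆ʳ = IsPartition-⊆ˡ ∘ IsPartition-swap

  ∩-∁-isPartition : ∀ (S M : Subset m) → IsPartition S (S ∩ M) (S ∩ ∁ M)
  ∩-∁-isPartition S M = union , disjoint
    where
    open ≡.≡-Reasoning
    union : (S ∩ M) ∪ (S ∩ ∁ M) ≡ S
    union = begin
      (S ∩ M) ∪ (S ∩ ∁ M) ≡⟨ ≡.sym (∩-distribˡ-∪ S M (∁ M)) ⟩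
      S ∩ (M ∪ ∁ M)       ≡⟨ cong (S ∩_) (p∪∁p≡⊤ M) ⟩
      S ∩ ⊤               ≡⟨ ∩-identityʳ S ⟩
      S                   ∎
    disjoint : Empty ((S ∩ M) ∩ (S ∩ ∁ M))
    disjoint (z , z∈) with x∈p∩q⁻ (S ∩ M) (S ∩ ∁ M) z∈
    ... | z∈S∩M , z∈S∩∁M = x∈p⇒x∉∁p (proj₂ (x∈p∩q⁻ S M z∈S∩M)) (proj₂ (x∈p∩q⁻ S (∁ M) z∈S∩∁M))

module _ {n : ℕ} (G : Graph n) where

  adj-sym : ∀ {x y} → Adj G x y → Adj G y x
  adj-sym {x} {y} xy = ≡.trans (sym G y x) xy

  adj⇒≢ : ∀ {x y} → Adj G x y → x ≢ y
  adj⇒≢ {x} xy refl = contradiction (≡.trans (≡.sym (irrefl G x)) xy) λ ()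

  adj? : ∀ x y → Dec (Adj G x y)
  adj? x y = adj G x y Bool.≟ true

  Touches : Fin n → Fin n → Set
  Touches u w = u ≡ w ⊎ Adj G u w

  touches? : ∀ u w → Dec (Touches u w)
  touches? u w = u Fin.≟ w ⊎-dec adj? u w

  record ChordlessCycle (p : ℕ → Fin n) (m : ℕ) : Set where
    field
      edge      : ∀ {i} → i < m → Adj G (p i) (p (suc i))
      close     : Adj G (p 0) (p m)
      chordless : ∀ {i j} → suc i < j → j ≤ m → ¬ (i ≡ 0 × j ≡ m) →
                  ¬ Adj G (p i) (p j) × p i ≢ p j

  module _ {p : ℕ → Fin n} {m : ℕ} (cycle : ChordlessCycle p m) where
    open ChordlessCycle cycle

    private
      toℕ≤m : ∀ (i : Fin (suc m)) → toℕ i ≤ m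
      toℕ≤m i = ≤-pred (toℕ<n i)

      distinct : ∀ {i j} → i < j → j ≤ m → p i ≢ p j
      distinct {i} {j} i<j j≤m with m≤n⇒m<n∨m≡n i<j | i ≟ 0 | j ≟ m
      ... | inj₂ refl | _        | _        = adj⇒≢ (edge j≤m)
      ... | inj₁ _    | yes refl | yes refl = adj⇒≢ close
      ... | inj₁ 1+i<j | no i≢0  | _        = proj₂ (chordless 1+i<j j≤m (i≢0 ∘ proj₁))
      ... | inj₁ 1+i<j | _       | no j≢m   = proj₂ (chordless 1+i<j j≤m (j≢m ∘ proj₂))

      non-adjacent : ∀ {i j} → i < j → j ≤ m → j ≢ suc i → ¬ (i ≡ 0 × j ≡ m) → ¬ Adj G (p i) (p j)
      non-adjacent i<j j≤m j≢1+i not-closing with m≤n⇒m<n∨m≡n i<j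
      ... | inj₁ 1+i<j = proj₁ (chordless 1+i<j j≤m not-closing)
      ... | inj₂ 1+i≡j = contradiction (≡.sym 1+i≡j) j≢1+i

    ChordlessCycle⇒IsCycle : IsCycle G (p ∘ toℕ {suc m})
    ChordlessCycle⇒IsCycle = injective , consecutive
      where
      injective : ∀ {i j : Fin (suc m)} → p (toℕ i) ≡ p (toℕ j) → i ≡ j
      injective {i} {j} eq with <-cmp (toℕ i) (toℕ j)
      ... | tri< i<j _ _ = contradiction eq (distinct i<j (toℕ≤m j))
      ... | tri≈ _ i≡j _ = toℕ-injective i≡j
      ... | tri> _ _ j<i = contradiction (≡.sym eq) (distinct j<i (toℕ≤m i))

      consecutive : ∀ i j → CycConsec {suc m} i j → Adj G (p (toℕ i)) (p (toℕ j))
      consecutive i j (inj₁ j≡1+i) =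
        subst (Adj G (p (toℕ i)) ∘ p) (≡.sym j≡1+i) (edge (subst (_≤ m) j≡1+i (toℕ≤m j)))
      consecutive i j (inj₂ (inj₁ i≡1+j)) = adj-sym (consecutive j i (inj₁ i≡1+j))
      consecutive i j (inj₂ (inj₂ (inj₁ (i≡0 , j≡m)))) =
        subst₂ (λ k l → Adj G (p k) (p l)) (≡.sym i≡0) (≡.sym j≡m) close
      consecutive i j (inj₂ (inj₂ (inj₂ ends))) = adj-sym (consecutive j i (inj₂ (inj₂ (inj₁ ends))))

    ChordlessCycle⇒¬HasChord : ¬ HasChord G (p ∘ toℕ {suc m})
    ChordlessCycle⇒¬HasChord (i , j , i≢j , ¬consecutive , i~j) with <-cmp (toℕ i) (toℕ j)
    ... | tri≈ _ i≡j _ = i≢j (toℕ-injective i≡j)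
    ... | tri< i<j _ _ =
      non-adjacent i<j (toℕ≤m j) (¬consecutive ∘ inj₁) (¬consecutive ∘ inj₂ ∘ inj₂ ∘ inj₁) i~j
    ... | tri> _ _ j<i =
      non-adjacent j<i (toℕ≤m i) (¬consecutive ∘ inj₂ ∘ inj₁) (¬consecutive ∘ inj₂ ∘ inj₂ ∘ inj₂)
        (adj-sym i~j)

  chordal⇒¬ChordlessCycle : Chordal G → ∀ {p m} → 3 ≤ m → ¬ ChordlessCycle p m
  chordal⇒¬ChordlessCycle chordal {m = m} 3≤m cycle =
    ChordlessCycle⇒¬HasChord cycle (chordal (suc m) (s≤s 3≤m) _ (ChordlessCycle⇒IsCycle cycle))

  record InducedPath (P : Fin n → Set) (m : ℕ) (u v : Fin n) : Set where
    field
      vertex    : ℕ → Fin n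
      start     : vertex 0 ≡ u
      end       : vertex m ≡ v
      edge      : ∀ {i} → i < m → Adj G (vertex i) (vertex (suc i))
      chordless : ∀ {i j} → suc i < j → j ≤ m → ¬ Adj G (vertex i) (vertex j) × vertex i ≢ vertex j
      inside    : ∀ {i} → i ≤ m → P (vertex i)

  open InducedPath

  module _ {P : Fin n → Set} where

    trivial : ∀ {u} → P u → InducedPath P 0 u u
    trivial {u} pu = record
      { vertex = λ _ → u ; start = refl ; end = refl ; edge = λ ()
      ; chordless = λ { (s≤s _) () } ; inside = λ _ → pu }

    tail : ∀ {m u v} (π : InducedPath P (suc m) u v) → InducedPath P m (vertex π 1) v
    tail π = record
      { vertex = vertex π ∘ suc ; start = refl ; end = end π
      ; edge = edge π ∘ s≤s ; chordless = λ 1+i<j j≤m → chordless π (s≤s 1+i<j) (s≤s j≤m)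
      ; inside = inside π ∘ s≤s }

    take : ∀ {m u v k} (π : InducedPath P m u v) → k ≤ m → InducedPath P k u (vertex π k)
    take π k≤m = record
      { vertex = vertex π ; start = start π ; end = refl
      ; edge = λ i<k → edge π (≤-trans i<k k≤m)
      ; chordless = λ 1+i<j j≤k → chordless π 1+i<j (≤-trans j≤k k≤m)
      ; inside = λ i≤k → inside π (≤-trans i≤k k≤m) }

    cons : ∀ {m w v} u → P u → Adj G u w → (π : InducedPath P m w v) →
           (∀ {k} → k < m → ¬ Touches u (vertex π (suc k))) → InducedPath P (suc m) u v
    cons u pu u~w π far = record
      { vertex = u ◃ vertex π ; start = refl ; end = end π
      ; edge = λ { {zero} _ → subst (Adj G u) (≡.sym (start π)) u~w ; {suc i} (s≤s i<m) → edge π i<m }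
      ; chordless = λ { {zero} (s≤s (s≤s _)) (s≤s k<m) → far k<m ∘ inj₂ , far k<m ∘ inj₁
                      ; {suc i} (s≤s 1+i<j) (s≤s j≤m) → chordless π 1+i<j j≤m }
      ; inside = λ { {zero} _ → pu ; {suc i} (s≤s i≤m) → inside π i≤m } }

    -- u is attached at the last vertex of π it touches; this keeps the path induced.
    prepend : ∀ {m w v} u → P u → (π : InducedPath P m w v) →
              ∃ (λ k → k ≤ m × Touches u (vertex π k)) → ∃ λ l → InducedPath P l u v
    prepend {m} u pu π touch with anyUpTo? (touches? u ∘ vertex π ∘ suc) m
    prepend {suc m} u pu π _ | yes (k , s≤s k≤m , t) = prepend u pu (tail π) (k , k≤m , t)
    prepend u pu π (suc k , k<m , t) | no far = contradiction (k , k<m , t) far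
    prepend u pu π (zero , _ , inj₁ u≡w) | no far =
      _ , subst (λ x → InducedPath P _ x _) (≡.trans (≡.sym (start π)) (≡.sym u≡w)) π
    prepend u pu π (zero , _ , inj₂ u~w) | no far =
      _ , cons u pu (subst (Adj G u) (start π) u~w) π (λ k<m t → far (_ , k<m , t))

    walk⇒InducedPath : ∀ {u v} → WalkIn G P u v → ∃ λ m → InducedPath P m u v
    walk⇒InducedPath (here pu) = 0 , trivial pu
    walk⇒InducedPath (step pu u~w walk) with walk⇒InducedPath walk
    ... | _ , π = prepend _ pu π (0 , z≤n , inj₂ (subst (Adj G _) (≡.sym (start π)) u~w))

  cone : ∀ {a m u v} (π : InducedPath (_≢ a) m u v) → Adj G a u → Adj G a v →
         (∀ {i} → 0 < i → i < m → ¬ Adj G a (vertex π i)) → ChordlessCycle (a ◃ vertex π) (suc m)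
  cone {a} {m} π a~u a~v interior = record
    { edge = λ { {zero} _ → subst (Adj G a) (≡.sym (start π)) a~u ; {suc i} (s≤s i<m) → edge π i<m }
    ; close = subst (Adj G a) (≡.sym (end π)) a~v
    ; chordless = chordless′ }
    where
    chordless′ : ∀ {i j} → suc i < j → j ≤ suc m → ¬ (i ≡ 0 × j ≡ suc m) →
                 ¬ Adj G ((a ◃ vertex π) i) ((a ◃ vertex π) j) × (a ◃ vertex π) i ≢ (a ◃ vertex π) j
    chordless′ {zero} {suc j} (s≤s 0<j) (s≤s j≤m) not-closing =
      interior 0<j (≤∧≢⇒< j≤m (λ j≡m → not-closing (refl , cong suc j≡m))) , ≢-sym (inside π j≤m)
    chordless′ {suc i} {suc j} (s≤s 1+i<j) (s≤s j≤m) _ = chordless π 1+i<j j≤m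

  module _ (chordal : Chordal G) where

    neighbour-of-ends⇒neighbour-of-second : ∀ {a m u v} (π : InducedPath (_≢ a) (suc m) u v) →
      Adj G a u → Adj G a v → Adj G a (vertex π 1)
    neighbour-of-ends⇒neighbour-of-second {a} π a~u a~v
      with least (adj? a ∘ vertex π ∘ suc) (subst (Adj G a) (≡.sym (end π)) a~v)
    ... | zero  , _     , a~q₁ , _      = a~q₁
    ... | suc j , j′≤m , a~qⱼ , before =
      contradiction (cone (take π (s≤s j′≤m)) a~u a~qⱼ interior)
                    (chordal⇒¬ChordlessCycle chordal (s≤s (s≤s (s≤s z≤n))))
      where
      interior : ∀ {i} → 0 < i → i < suc (suc j) → ¬ Adj G a (vertex π i)
      interior {suc i} _ (s≤s i<1+j) = before i<1+j

    module _ {T : Subset n} (convex : ΔConvex G T) {a} (a∈T : a ∈ T) where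

      fan-start∈ : ∀ {m u v} (π : InducedPath (_≢ a) m u v) → Adj G a u → Adj G a v → v ∈ T → u ∈ T
      fan-start∈ {zero} π _ _ v∈T = subst (_∈ T) (≡.trans (≡.sym (end π)) (start π)) v∈T
      fan-start∈ {suc m} {u} π a~u a~v v∈T = convex a (vertex π 1) u a∈T q₁∈T a~q₁ (adj-sym a~u) u~q₁
        where
        a~q₁ : Adj G a (vertex π 1)
        a~q₁ = neighbour-of-ends⇒neighbour-of-second π a~u a~v
        q₁∈T : vertex π 1 ∈ T
        q₁∈T = fan-start∈ (tail π) a~q₁ a~v v∈T
        u~q₁ : Adj G u (vertex π 1)
        u~q₁ = subst (λ x → Adj G x (vertex π 1)) (start π) (edge π (s≤s z≤n))

    module _ (no-cut-vertex : ∀ x → ConnectedWithout G x) {T : Subset n} (convex : ΔConvex G T) where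

      ΔConvex-neighbour∈ : ∀ {a b v} → a ∈ T → b ∈ T → Adj G a b → Adj G a v → v ∈ T
      ΔConvex-neighbour∈ {a} {b} {v} a∈T b∈T a~b a~v
        with walk⇒InducedPath (no-cut-vertex a v b (≢-sym (adj⇒≢ a~v)) (≢-sym (adj⇒≢ a~b)))
      ... | _ , π = fan-start∈ convex a∈T π a~v a~b b∈T

      ΔConvex-walk-end∈ : ∀ {Q u z} → WalkIn G Q u z → u ∈ T → ∀ {w} → w ∈ T → Adj G u w → z ∈ T
      ΔConvex-walk-end∈ (here _)            u∈T w∈T u~w = u∈T
      ΔConvex-walk-end∈ (step _ u~u′ walk) u∈T w∈T u~w =
        ΔConvex-walk-end∈ walk (ΔConvex-neighbour∈ u∈T w∈T u~w u~u′) u∈T (adj-sym u~u′)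

  edge⇒InHull : Chordal G → TwoConnected G → ∀ {S x y} → Adj G x y → x ∈ S → y ∈ S →
                ∀ z → InHull G S z
  edge⇒InHull chordal (_ , connected , no-cut-vertex) {x = x} x~y x∈S y∈S z T S⊆T convex =
    ΔConvex-walk-end∈ chordal no-cut-vertex convex (connected x z) (S⊆T x∈S) (S⊆T y∈S) x~y

  ∈⇒InHull : ∀ {S v} → v ∈ S → InHull G S v
  ∈⇒InHull v∈S _ S⊆T _ = S⊆T v∈S

  InHull-independent : ∀ {U v} → Independent G U → InHull G U v → v ∈ U
  InHull-independent independent inHull =
    inHull _ (λ x∈ → x∈) λ x y _ x∈ y∈ x~y _ _ → contradiction x~y (independent x y x∈ y∈)

  Empty⇒¬InHull : ∀ {U v} → Empty U → ¬ InHull G U v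
  Empty⇒¬InHull {v = v} empty inHull =
    empty (v , InHull-independent (λ x _ x∈ _ _ → empty (x , x∈)) inHull)

  independent-or-edge : ∀ U → Independent G U ⊎ ∃ λ x → ∃ λ y → x ∈ U × y ∈ U × Adj G x y
  independent-or-edge U with any? (λ x → any? (λ y → x ∈? U ×-dec y ∈? U ×-dec adj? x y))
  ... | yes (x , y , edge) = inj₂ (x , y , edge)
  ... | no  ¬edge          = inj₁ λ x y x∈ y∈ x~y → ¬edge (x , y , x∈ , y∈ , x~y)

  independent-parts⇒disjoint-hulls : ∀ {S S₁ S₂ v} → IsPartition S S₁ S₂ →
    Independent G S₁ → Independent G S₂ → InHull G S₁ v → InHull G S₂ v → ⊥
  independent-parts⇒disjoint-hulls {v = v} (_ , disjoint) ind₁ ind₂ h₁ h₂ =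
    disjoint (v , x∈p∩q⁺ (InHull-independent ind₁ h₁ , InHull-independent ind₂ h₂))

  pair-edge⇒other-part-empty : ∀ {x y S₁ S₂ p q} → IsPartition (⁅ x ⁆ ∪ ⁅ y ⁆) S₁ S₂ →
    p ∈ S₁ → q ∈ S₁ → Adj G p q → Empty S₂
  pair-edge⇒other-part-empty part@(_ , disjoint) p∈ q∈ p~q (z , z∈S₂)
    with ≢-pair-covers (∈⁅x⁆∪⁅y⁆⇒ (IsPartition-⊆ˡ part p∈)) (∈⁅x⁆∪⁅y⁆⇒ (IsPartition-⊆ˡ part q∈))
                       (adj⇒≢ p~q) (∈⁅x⁆∪⁅y⁆⇒ (IsPartition-⊆ʳ part z∈S₂))
  ... | inj₁ refl = disjoint (z , x∈p∩q⁺ (p∈ , z∈S₂))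
  ... | inj₂ refl = disjoint (z , x∈p∩q⁺ (q∈ , z∈S₂))

  independent⇒¬RadonDependent : ∀ {S} → Independent G S → ¬ RadonDependent G S
  independent⇒¬RadonDependent independent (_ , _ , part , _ , h₁ , h₂) =
    independent-parts⇒disjoint-hulls part
      (restrict (IsPartition-⊆ˡ part)) (restrict (IsPartition-⊆ʳ part)) h₁ h₂
    where
    restrict : ∀ {U} → U ⊆ _ → Independent G U
    restrict U⊆S x y x∈ y∈ = independent x y (U⊆S x∈) (U⊆S y∈)

  pair-¬RadonDependent : ∀ x y → ¬ RadonDependent G (⁅ x ⁆ ∪ ⁅ y ⁆)
  pair-¬RadonDependent x y (S₁ , S₂ , part , v , h₁ , h₂)
    with independent-or-edge S₁ | independent-or-edge S₂
  ... | inj₂ (_ , _ , p∈ , q∈ , p~q) | _ =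
    Empty⇒¬InHull (pair-edge⇒other-part-empty part p∈ q∈ p~q) h₂
  ... | _ | inj₂ (_ , _ , p∈ , q∈ , p~q) =
    Empty⇒¬InHull (pair-edge⇒other-part-empty (IsPartition-swap part) p∈ q∈ p~q) h₁
  ... | inj₁ ind₁ | inj₁ ind₂ = independent-parts⇒disjoint-hulls part ind₁ ind₂ h₁ h₂

  edge-and-outsider⇒RadonDependent : Chordal G → TwoConnected G → ∀ {S x y} → Adj G x y →
    x ∈ S → y ∈ S → Nonempty (S ∩ ∁ (⁅ x ⁆ ∪ ⁅ y ⁆)) → RadonDependent G S
  edge-and-outsider⇒RadonDependent chordal 2-connected {S} {x} {y} x~y x∈S y∈S (z , z∈) =
    S ∩ M , S ∩ ∁ M , ∩-∁-isPartition S M , z ,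
    edge⇒InHull chordal 2-connected x~y
      (x∈p∩q⁺ (x∈S , x∈⁅x⁆∪⁅y⁆ x y)) (x∈p∩q⁺ (y∈S , y∈⁅x⁆∪⁅y⁆ x y)) z ,
    ∈⇒InHull z∈
    where
    M = ⁅ x ⁆ ∪ ⁅ y ⁆

  large⇒RadonDependent : Chordal G → TwoConnected G → ∀ {a} → (∀ S → Independent G S → ∣ S ∣ ≤ a) →
    ∀ S → 2 ⊔ a < ∣ S ∣ → RadonDependent G S
  large⇒RadonDependent chordal 2-connected {a} α-bound S large with independent-or-edge S
  ... | inj₁ independent = contradiction (α-bound S independent) (<⇒≱ (≤-<-trans (m≤n⊔m 2 a) large))
  ... | inj₂ (x , y , x∈S , y∈S , x~y) with nonempty? (S ∩ ∁ (⁅ x ⁆ ∪ ⁅ y ⁆))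
  ...   | yes outsider = edge-and-outsider⇒RadonDependent chordal 2-connected x~y x∈S y∈S outsider
  ...   | no  none     = contradiction (≤-trans (p⊆q⇒∣p∣≤∣q∣ (Empty[p∩∁q]⇒p⊆q none)) (∣⁅x⁆∪⁅y⁆∣≤2 x y))
                                       (<⇒≱ (≤-<-trans (m≤m⊔n 2 a) large))

  RadonIndependent⇒≤ : ∀ {m S} → (∀ S → m < ∣ S ∣ → RadonDependent G S) →
                       ¬ RadonDependent G S → ∣ S ∣ ≤ m
  RadonIndependent⇒≤ dependent independent = ≮⇒≥ (independent ∘ dependent _)

corollary2 : ∀ {n : ℕ} (G : Graph n) → Connected G → TwoConnected G → Chordal G
    → ∀ (a : ℕ) → IsIndependenceNumber G a → IsRadonNumber G (2 ⊔ a)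
corollary2 G _ 2-connected@(s≤s (s≤s (s≤s _)) , _) chordal a ((I , independent , ∣I∣≡a) , α-bound) =
  large⇒RadonDependent G chordal 2-connected α-bound ,
  λ _ dependent → ⊔-lub (2≤ dependent) (a≤ dependent)
  where
  2≤ : ∀ {m} → (∀ S → m < ∣ S ∣ → RadonDependent G S) → 2 ≤ m
  2≤ dependent =
    ≤-trans (s≤s (s≤s z≤n)) (RadonIndependent⇒≤ G dependent (pair-¬RadonDependent G zero (suc zero)))
  a≤ : ∀ {m} → (∀ S → m < ∣ S ∣ → RadonDependent G S) → a ≤ m
  a≤ dependent =
    subst (_≤ _) ∣I∣≡a (RadonIndependent⇒≤ G dependent (independent⇒¬RadonDependent G independent))
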